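{- For every real number $\beta$, there are only finitely many admissible multi-indices $\mathbf{k}$ with $t(\mathbf{k})_{1}=\beta$.
   Context: An admissible multi-index is a finite sequence $\mathbf{k}=(k_1,\ldots,k_d)$, $d\ge1$, of positive integers with $k_1>1$. The tail multiple $t$-value is $t(\mathbf{k})_{1}=\sum_{m_1>\cdots>m_d>1}\prod_{i=1}^d (2m_i-1)^{ -k_i}$. -}

module Defs where

open import Data.Nat using (ℕ; zero; suc; _≤_; _*_)
open import Data.Integer using (+_)
open import Data.Rational.Unnormalised using (ℚᵘ; _/_; 0ℚᵘ; 1ℚᵘ; _+_; _-_; ∣_∣) renaming (_*_ to _*ℚ_; _<_ to _<ℚ_)
open import Data.List using (List; []; _∷_)
open import Data.List.Relation.Unary.All using (All)
open import Data.Empty using (⊥)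
open import Data.Product using (_×_; ∃-syntax)

Admissible : List ℕ → Set
Admissible []       = ⊥
Admissible (k ∷ ks) = 2 ≤ k × All (1 ≤_) ks

-- 1 / (2m - 1) for m ≥ 2, i.e. m = 2 + j, 2m - 1 = 3 + 2j.  (Value at m = 0, 1 never used.)
oddRecip : ℕ → ℚᵘ
oddRecip (suc (suc j)) = + 1 / suc (suc (suc (2 * j)))
oddRecip _             = 0ℚᵘ

pow : ℚᵘ → ℕ → ℚᵘ
pow q zero    = 1ℚᵘ
pow q (suc k) = q *ℚ pow q k

sumFrom2Below : ℕ → (ℕ → ℚᵘ) → ℚᵘ
sumFrom2Below zero          f = 0ℚᵘ
sumFrom2Below (suc zero)    f = 0ℚᵘ
sumFrom2Below (suc (suc zero)) f = 0ℚᵘ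
sumFrom2Below (suc (suc (suc n))) f = sumFrom2Below (suc (suc n)) f + f (suc (suc n))

-- tBelow k M = Σ_{M > m₁ > ⋯ > m_d > 1} ∏ (2mᵢ - 1)^{-kᵢ}   (empty index gives 1)
tBelow : List ℕ → ℕ → ℚᵘ
tBelow []       M = 1ℚᵘ
tBelow (k ∷ ks) M = sumFrom2Below M (λ m → pow (oddRecip m) k *ℚ tBelow ks m)

-- N-th partial sum of t(k)_1 : Σ_{N ≥ m₁ > ⋯ > m_d > 1} ∏ (2mᵢ - 1)^{-kᵢ}
tPartial : List ℕ → ℕ → ℚᵘ
tPartial k N = tBelow k (suc N)

TendsToZero : (ℕ → ℚᵘ) → Set
TendsToZero a = ∀ (ε : ℚᵘ) → 0ℚᵘ <ℚ ε → ∃[ N ] (∀ n → N ≤ n → ∣ a n ∣ <ℚ ε)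

-- t(k)_1 = β, where the real β is given as the limit of a sequence of rationals β:
-- the partial sums of t(k)_1 and β differ by a null sequence.
tEq : List ℕ → (ℕ → ℚᵘ) → Set
tEq k β = TendsToZero (λ n → tPartial k n - β n)

{-# OPTIONS --safe #-}
module Submission where

-- For m ≥ 2 let x m = 1 / (2m − 1) ≤ 1/3 and g m = ∏_{j<m} (1 + (3/2) x j).  Since (2/3)(3/2) = 1,
-- Σ_{2≤j<m} x j g j ≤ (2/3) g m, and as x^k ≤ (2/3)^(k−1) x, induction along the index bounds the
-- truncated sums of an index ks with positive entries by (2/3)^(weight ks) g m.  The leading entry
-- 2 + a of an admissible index leaves one more factor x j, and Σ x j² g j ≤ 4/3 telescopes; hence
-- every partial sum of t(k)_1 is at most 2 (2/3)^(weight k − 2).  If some k₀ solves t(k₀)_1 = β then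
-- β is at least a positive partial sum of t(k₀)_1, so solutions have bounded weight and lie in a finite
-- list.  Existence of a solution cannot be decided constructively, whence the double negation.

open import Defs
open import Data.Nat using (ℕ)
open import Data.Rational.Unnormalised using (ℚᵘ)
open import Data.List using (List)
open import Data.List.Membership.Propositional using (_∈_)
open import Data.Product using (∃-syntax)
open import Relation.Nullary using (¬_)

open import Data.Nat as ℕ using (zero; suc; z≤n; s≤s; _⊔_)
import Data.Nat.Properties as ℕP
open import Data.Nat.ListAction using () renaming (sum to weight)
open import Data.Nat.Tactic.RingSolver using () renaming (solve to ℕ-solve)
open import Data.Integer as ℤ using (+_; +[1+_]; -[1+_])
open import Data.Rational.Unnormalised
  using (mkℚᵘ; 0ℚᵘ; 1ℚᵘ; _≃_; _≤_; _<_; *≤*; *<*; *≡*; _+_; _*_; _-_; _/_; -_; ∣_∣; nonNegative; positive)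
import Data.Rational.Unnormalised.Properties as ℚP
open import Data.Rational.Unnormalised.Solver using (module +-*-Solver)
open +-*-Solver using (solve; _:+_; _:*_; _:-_; :-_; _:=_; con)
open import Data.List using ([]; _∷_; [_]; length; upTo; cartesianProductWith)
open import Data.List.Relation.Unary.All as All using (All; []; _∷_)
open import Data.List.Relation.Unary.Any using (here; there)
open import Data.List.Membership.Propositional.Properties using (∈-upTo⁺; ∈-cartesianProductWith⁺)
open import Data.Empty using (⊥-elim)
open import Data.Sum using (inj₁; inj₂)
open import Data.Product using (_,_; _×_)
open import Data.Unit using (tt)
open import Relation.Binary.PropositionalEquality using (refl; cong; sym; subst)
open import Relation.Nullary using (Dec; yes; no; ¬¬-excluded-middle)
open import Relation.Nullary.Negation using (¬¬-map)

0≤* : ∀ {p q} → 0ℚᵘ ≤ p → 0ℚᵘ ≤ q → 0ℚᵘ ≤ p * q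
0≤* {p} {q} 0≤p 0≤q =
  ℚP.nonNegative⁻¹ (p * q) {{ℚP.nonNeg*nonNeg⇒nonNeg p {{nonNegative 0≤p}} q {{nonNegative 0≤q}}}}

0<* : ∀ {p q} → 0ℚᵘ < p → 0ℚᵘ < q → 0ℚᵘ < p * q
0<* {p} {q} 0<p 0<q =
  ℚP.positive⁻¹ (p * q) {{ℚP.pos*pos⇒pos p {{positive 0<p}} q {{positive 0<q}}}}

*-mono-≤-0≤ : ∀ {p q u v} → 0ℚᵘ ≤ p → 0ℚᵘ ≤ u → p ≤ q → u ≤ v → p * u ≤ q * v
*-mono-≤-0≤ 0≤p 0≤u = ℚP.*-mono-≤-nonNeg {{nonNegative 0≤p}} {{nonNegative 0≤u}}

*-monoʳ-≤-0≤ : ∀ c {u v} → 0ℚᵘ ≤ c → u ≤ v → c * u ≤ c * v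
*-monoʳ-≤-0≤ c 0≤c = ℚP.*-monoʳ-≤-nonNeg c {{nonNegative 0≤c}}

p≤∣p∣ : ∀ p → p ≤ ∣ p ∣
p≤∣p∣ p with ℚP.∣p∣≡p∨∣p∣≡-p p
... | inj₁ ∣p∣≡p  = ℚP.≤-reflexive-≡ (sym ∣p∣≡p)
... | inj₂ ∣p∣≡-p = ℚP.≤-trans p≤0 (ℚP.0≤∣p∣ p)
  where
  p≤0 : p ≤ 0ℚᵘ
  p≤0 = subst (_≤ 0ℚᵘ) (ℚP.neg-involutive-≡ p) (ℚP.neg-mono-≤ (subst (0ℚᵘ ≤_) ∣p∣≡-p (ℚP.0≤∣p∣ p)))

-p≤∣p∣ : ∀ p → - p ≤ ∣ p ∣
-p≤∣p∣ p = subst (- p ≤_) (ℚP.∣-p∣≡∣p∣ p) (p≤∣p∣ (- p))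

sumFrom2Below-nonNeg : ∀ {f} → (∀ m → 0ℚᵘ ≤ f m) → ∀ M → 0ℚᵘ ≤ sumFrom2Below M f
sumFrom2Below-nonNeg 0≤f zero                = ℚP.≤-refl
sumFrom2Below-nonNeg 0≤f (suc zero)          = ℚP.≤-refl
sumFrom2Below-nonNeg 0≤f (suc (suc zero))    = ℚP.≤-refl
sumFrom2Below-nonNeg 0≤f (suc M@(suc (suc _))) =
  ℚP.+-mono-≤ (sumFrom2Below-nonNeg 0≤f M) (0≤f M)

sumFrom2Below-≤-*ˡ : ∀ c {f h} → (∀ m → f m ≤ c * h m) →
                     ∀ M → sumFrom2Below M f ≤ c * sumFrom2Below M h
sumFrom2Below-≤-*ˡ c f≤ch zero                = ℚP.≤-reflexive (ℚP.≃-sym (ℚP.*-zeroʳ c))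
sumFrom2Below-≤-*ˡ c f≤ch (suc zero)          = ℚP.≤-reflexive (ℚP.≃-sym (ℚP.*-zeroʳ c))
sumFrom2Below-≤-*ˡ c f≤ch (suc (suc zero))    = ℚP.≤-reflexive (ℚP.≃-sym (ℚP.*-zeroʳ c))
sumFrom2Below-≤-*ˡ c {f} {h} f≤ch (suc M@(suc (suc _))) = begin
  sumFrom2Below M f + f M          ≤⟨ ℚP.+-mono-≤ (sumFrom2Below-≤-*ˡ c f≤ch M) (f≤ch M) ⟩
  c * sumFrom2Below M h + c * h M  ≃⟨ ℚP.≃-sym (ℚP.*-distribˡ-+ c _ _) ⟩
  c * (sumFrom2Below M h + h M)    ∎
  where open ℚP.≤-Reasoning

sumFrom2Below-≤-suc : ∀ {f} → (∀ m → 0ℚᵘ ≤ f m) → ∀ M → sumFrom2Below M f ≤ sumFrom2Below (suc M) f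
sumFrom2Below-≤-suc 0≤f zero               = ℚP.≤-refl
sumFrom2Below-≤-suc 0≤f (suc zero)         = ℚP.≤-refl
sumFrom2Below-≤-suc {f} 0≤f M@(suc (suc _)) = ℚP.p≤p+q _ (f M) {{nonNegative (0≤f M)}}

pow-nonNeg : ∀ {q} → 0ℚᵘ ≤ q → ∀ k → 0ℚᵘ ≤ pow q k
pow-nonNeg 0≤q zero    = ℚP.nonNegative⁻¹ 1ℚᵘ
pow-nonNeg 0≤q (suc k) = 0≤* 0≤q (pow-nonNeg 0≤q k)

pow-pos : ∀ {q} → 0ℚᵘ < q → ∀ k → 0ℚᵘ < pow q k
pow-pos 0<q zero    = ℚP.positive⁻¹ 1ℚᵘ
pow-pos 0<q (suc k) = 0<* 0<q (pow-pos 0<q k)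

pow-mono-≤ : ∀ {q s} → 0ℚᵘ ≤ q → q ≤ s → ∀ k → pow q k ≤ pow s k
pow-mono-≤ 0≤q q≤s zero    = ℚP.≤-refl
pow-mono-≤ 0≤q q≤s (suc k) = *-mono-≤-0≤ 0≤q (pow-nonNeg 0≤q k) q≤s (pow-mono-≤ 0≤q q≤s k)

pow-distribˡ-+-* : ∀ q m n → pow q (m ℕ.+ n) ≃ pow q m * pow q n
pow-distribˡ-+-* q zero    n = ℚP.≃-sym (ℚP.*-identityˡ (pow q n))
pow-distribˡ-+-* q (suc m) n = ℚP.≃-trans (ℚP.*-congˡ {q} (pow-distribˡ-+-* q m n))
                                          (ℚP.≃-sym (ℚP.*-assoc q (pow q m) (pow q n)))

pow-suc-≤ : ∀ {q s} → 0ℚᵘ ≤ q → q ≤ s → ∀ k → pow q (suc k) ≤ pow s k * q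
pow-suc-≤ {q} 0≤q q≤s k = ℚP.≤-trans (ℚP.≤-reflexive (ℚP.*-comm q (pow q k)))
                                     (ℚP.*-monoˡ-≤-nonNeg q {{nonNegative 0≤q}} (pow-mono-≤ 0≤q q≤s k))

pow-2+-≤ : ∀ {q s} → 0ℚᵘ ≤ q → q ≤ s → ∀ k → pow q (2 ℕ.+ k) ≤ pow s k * (q * q)
pow-2+-≤ {q} {s} 0≤q q≤s k = begin
  q * pow q (suc k)   ≤⟨ *-monoʳ-≤-0≤ q 0≤q (pow-suc-≤ 0≤q q≤s k) ⟩
  q * (pow s k * q)   ≃⟨ solve 2 (λ q p → q :* (p :* q) := p :* (q :* q)) ℚP.≃-refl q (pow s k) ⟩
  pow s k * (q * q)   ∎
  where open ℚP.≤-Reasoning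

oddRecip-nonNeg : ∀ m → 0ℚᵘ ≤ oddRecip m
oddRecip-nonNeg zero          = ℚP.≤-refl
oddRecip-nonNeg (suc zero)    = ℚP.≤-refl
oddRecip-nonNeg (suc (suc j)) = ℚP.nonNegative⁻¹ _

oddRecip-pos : ∀ j → 0ℚᵘ < oddRecip (2 ℕ.+ j)
oddRecip-pos j = ℚP.positive⁻¹ _

⅓ ⅔ ³⁄₂ : ℚᵘ
⅓  = + 1 / 3
⅔  = + 2 / 3
³⁄₂ = + 3 / 2

oddRecip-≤⅓ : ∀ m → oddRecip m ≤ ⅓
oddRecip-≤⅓ zero          = ℚP.nonNegative⁻¹ _
oddRecip-≤⅓ (suc zero)    = ℚP.nonNegative⁻¹ _
oddRecip-≤⅓ (suc (suc j)) = *≤* (ℤ.+≤+ (s≤s (s≤s (s≤s z≤n))))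

oddRecip-recurrence : ∀ j → oddRecip (3 ℕ.+ j) * (1ℚᵘ + + 2 / 1 * oddRecip (2 ℕ.+ j)) ≃ oddRecip (2 ℕ.+ j)
oddRecip-recurrence j = *≡* (cong +_ (ℕ-solve [ j ]))

0≤⅔ : 0ℚᵘ ≤ ⅔
0≤⅔ = ℚP.nonNegative⁻¹ ⅔

oddRecip-≤⅔ : ∀ m → oddRecip m ≤ ⅔
oddRecip-≤⅔ m = ℚP.≤-trans (oddRecip-≤⅓ m) (ℚP.≤ᵇ⇒≤ tt)

-- ³⁄₂ < 2 keeps g m ≈ m^(3/4) small enough for Σ x j² g j to converge.
growth : ℕ → ℚᵘ
growth zero    = 1ℚᵘ
growth (suc m) = growth m + ³⁄₂ * (oddRecip m * growth m)

1≤growth : ∀ m → 1ℚᵘ ≤ growth m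
1≤growth zero    = ℚP.≤-refl
1≤growth (suc m) = ℚP.≤-trans (1≤growth m) (ℚP.p≤p+q (growth m) _ {{nonNegative 0≤increment}})
  where
  0≤increment : 0ℚᵘ ≤ ³⁄₂ * (oddRecip m * growth m)
  0≤increment = 0≤* (ℚP.nonNegative⁻¹ ³⁄₂)
                    (0≤* (oddRecip-nonNeg m) (ℚP.≤-trans (ℚP.nonNegative⁻¹ 1ℚᵘ) (1≤growth m)))

growth-nonNeg : ∀ m → 0ℚᵘ ≤ growth m
growth-nonNeg m = ℚP.≤-trans (ℚP.nonNegative⁻¹ 1ℚᵘ) (1≤growth m)

sum-oddRecip-growth-≤ : ∀ M → sumFrom2Below M (λ j → oddRecip j * growth j) ≤ ⅔ * growth M
sum-oddRecip-growth-≤ zero             = 0≤* 0≤⅔ (growth-nonNeg 0)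
sum-oddRecip-growth-≤ (suc zero)       = 0≤* 0≤⅔ (growth-nonNeg 1)
sum-oddRecip-growth-≤ (suc (suc zero)) = 0≤* 0≤⅔ (growth-nonNeg 2)
sum-oddRecip-growth-≤ (suc M@(suc (suc _))) = begin
  sumFrom2Below M xg + xg M   ≤⟨ ℚP.+-monoˡ-≤ (xg M) (sum-oddRecip-growth-≤ M) ⟩
  ⅔ * growth M + xg M         ≃⟨ ℚP.+-congʳ (⅔ * growth M) (ℚP.≃-sym (ℚP.*-identityˡ (xg M))) ⟩
  ⅔ * growth M + 1ℚᵘ * xg M   ≃⟨ ℚP.+-congʳ (⅔ * growth M) (ℚP.*-congʳ {xg M} {1ℚᵘ} {⅔ * ³⁄₂} (*≡* refl)) ⟩
  ⅔ * growth M + (⅔ * ³⁄₂) * xg M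
    ≃⟨ solve 4 (λ r l g xg → r :* g :+ (r :* l) :* xg := r :* (g :+ l :* xg)) ℚP.≃-refl ⅔ ³⁄₂ (growth M) (xg M) ⟩
  ⅔ * growth (suc M)          ∎
  where
  open ℚP.≤-Reasoning
  xg : ℕ → ℚᵘ
  xg j = oddRecip j * growth j

tBelow-nonNeg : ∀ ks M → 0ℚᵘ ≤ tBelow ks M
tBelow-nonNeg []       M = ℚP.nonNegative⁻¹ 1ℚᵘ
tBelow-nonNeg (k ∷ ks) M =
  sumFrom2Below-nonNeg (λ j → 0≤* (pow-nonNeg (oddRecip-nonNeg j) k) (tBelow-nonNeg ks j)) M

tBelow-≤-growth : ∀ ks → All (1 ℕ.≤_) ks → ∀ m → tBelow ks m ≤ pow ⅔ (weight ks) * growth m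
tBelow-≤-growth []           []         m =
  ℚP.≤-trans (1≤growth m) (ℚP.≤-reflexive (ℚP.≃-sym (ℚP.*-identityˡ (growth m))))
tBelow-≤-growth (suc k ∷ ks) (_ ∷ ks≥1) m = begin
  sumFrom2Below m (λ j → pow (oddRecip j) (suc k) * tBelow ks j)
    ≤⟨ sumFrom2Below-≤-*ˡ c termwise m ⟩
  c * sumFrom2Below m (λ j → oddRecip j * growth j)
    ≤⟨ *-monoʳ-≤-0≤ c (pow-nonNeg 0≤⅔ (k ℕ.+ weight ks)) (sum-oddRecip-growth-≤ m) ⟩
  c * (⅔ * growth m)
    ≃⟨ solve 3 (λ c r g → c :* (r :* g) := (r :* c) :* g) ℚP.≃-refl c ⅔ (growth m) ⟩
  (⅔ * c) * growth m ∎
  where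
  open ℚP.≤-Reasoning
  c : ℚᵘ
  c = pow ⅔ (k ℕ.+ weight ks)
  termwise : ∀ j → pow (oddRecip j) (suc k) * tBelow ks j ≤ c * (oddRecip j * growth j)
  termwise j = begin
    pow (oddRecip j) (suc k) * tBelow ks j
      ≤⟨ *-mono-≤-0≤ (pow-nonNeg (oddRecip-nonNeg j) (suc k)) (tBelow-nonNeg ks j)
                     (pow-suc-≤ (oddRecip-nonNeg j) (oddRecip-≤⅔ j) k) (tBelow-≤-growth ks ks≥1 j) ⟩
    (pow ⅔ k * oddRecip j) * (pow ⅔ (weight ks) * growth j)
      ≃⟨ solve 4 (λ a x b g → (a :* x) :* (b :* g) := (a :* b) :* (x :* g))
               ℚP.≃-refl (pow ⅔ k) (oddRecip j) (pow ⅔ (weight ks)) (growth j) ⟩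
    (pow ⅔ k * pow ⅔ (weight ks)) * (oddRecip j * growth j)
      ≃⟨ ℚP.*-congʳ (ℚP.≃-sym (pow-distribˡ-+-* ⅔ k (weight ks))) ⟩
    c * (oddRecip j * growth j) ∎

-- x j² g j ≤ potential j − potential (1 + j) for j ≥ 2, so Σ x j² g j telescopes.
potential : ℕ → ℚᵘ
potential m = + 4 / 1 * (oddRecip m * growth m)

-- With X = x (2+j), Y = x (3+j), G = g (2+j), the difference is G X Y (1 - 2X) ≥ 0 once
-- the recurrence X - Y (1 + 2X) = 0 is used.
potential-step : ∀ j → oddRecip (2 ℕ.+ j) * oddRecip (2 ℕ.+ j) * growth (2 ℕ.+ j) + potential (3 ℕ.+ j)
                       ≤ potential (2 ℕ.+ j)
potential-step j = begin
  X * X * G + potential (3 ℕ.+ j)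
    ≤⟨ ℚP.p≤p+q _ surplus {{nonNegative 0≤surplus}} ⟩
  X * X * G + potential (3 ℕ.+ j) + surplus
    ≃⟨ ℚP.≃-sym (ℚP.+-identityʳ _) ⟩
  X * X * G + potential (3 ℕ.+ j) + surplus + 0ℚᵘ
    ≃⟨ ℚP.+-congʳ (X * X * G + potential (3 ℕ.+ j) + surplus) recurrence-defect ⟩
  X * X * G + potential (3 ℕ.+ j) + surplus + (+ 4 / 1 - X) * G * (X - Y * (1ℚᵘ + + 2 / 1 * X))
    ≃⟨ solve 3 (λ X Y G →
         X :* X :* G :+ con (+ 4 / 1) :* (Y :* (G :+ con ³⁄₂ :* (X :* G)))
           :+ G :* X :* Y :* (con 1ℚᵘ :- con (+ 2 / 1) :* X)
           :+ (con (+ 4 / 1) :- X) :* G :* (X :- Y :* (con 1ℚᵘ :+ con (+ 2 / 1) :* X))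
         := con (+ 4 / 1) :* (X :* G)) ℚP.≃-refl X Y G ⟩
  potential (2 ℕ.+ j) ∎
  where
  open ℚP.≤-Reasoning
  X Y G surplus : ℚᵘ
  X = oddRecip (2 ℕ.+ j)
  Y = oddRecip (3 ℕ.+ j)
  G = growth (2 ℕ.+ j)
  surplus = G * X * Y * (1ℚᵘ - + 2 / 1 * X)
  twoX≤1 : + 2 / 1 * X ≤ 1ℚᵘ
  twoX≤1 = ℚP.≤-trans (*-monoʳ-≤-0≤ (+ 2 / 1) (ℚP.nonNegative⁻¹ (+ 2 / 1)) (oddRecip-≤⅓ (2 ℕ.+ j))) (ℚP.≤ᵇ⇒≤ tt)
  0≤surplus : 0ℚᵘ ≤ surplus
  0≤surplus = 0≤* (0≤* (0≤* (growth-nonNeg (2 ℕ.+ j)) (oddRecip-nonNeg (2 ℕ.+ j))) (oddRecip-nonNeg (3 ℕ.+ j)))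
                  (ℚP.p≤q⇒0≤q-p twoX≤1)
  recurrence-defect : 0ℚᵘ ≃ (+ 4 / 1 - X) * G * (X - Y * (1ℚᵘ + + 2 / 1 * X))
  recurrence-defect = ℚP.≃-sym (ℚP.≃-trans (ℚP.*-congˡ {(+ 4 / 1 - X) * G}
                                             (ℚP.p≃q⇒p-q≃0 X _ (ℚP.≃-sym (oddRecip-recurrence j))))
                                           (ℚP.*-zeroʳ ((+ 4 / 1 - X) * G)))

potential-nonNeg : ∀ m → 0ℚᵘ ≤ potential m
potential-nonNeg m = 0≤* (ℚP.nonNegative⁻¹ (+ 4 / 1)) (0≤* (oddRecip-nonNeg m) (growth-nonNeg m))

sum-oddRecip²-growth-telescope : ∀ M → sumFrom2Below M (λ j → oddRecip j * oddRecip j * growth j) + potential M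
                                       ≤ potential 2
sum-oddRecip²-growth-telescope zero             = ℚP.≤ᵇ⇒≤ tt
sum-oddRecip²-growth-telescope (suc zero)       = ℚP.≤ᵇ⇒≤ tt
sum-oddRecip²-growth-telescope (suc (suc zero)) = ℚP.≤ᵇ⇒≤ tt
sum-oddRecip²-growth-telescope (suc M@(suc (suc j))) = begin
  (sumFrom2Below M xxg + xxg M) + potential (suc M)   ≃⟨ ℚP.+-assoc (sumFrom2Below M xxg) (xxg M) _ ⟩
  sumFrom2Below M xxg + (xxg M + potential (suc M))   ≤⟨ ℚP.+-monoʳ-≤ (sumFrom2Below M xxg) (potential-step j) ⟩
  sumFrom2Below M xxg + potential M                   ≤⟨ sum-oddRecip²-growth-telescope M ⟩
  potential 2                                         ∎
  where
  open ℚP.≤-Reasoning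
  xxg : ℕ → ℚᵘ
  xxg j = oddRecip j * oddRecip j * growth j

sum-oddRecip²-growth-≤ : ∀ M → sumFrom2Below M (λ j → oddRecip j * oddRecip j * growth j) ≤ + 2 / 1
sum-oddRecip²-growth-≤ M = ℚP.≤-trans (ℚP.p≤p+q _ (potential M) {{nonNegative (potential-nonNeg M)}})
                          (ℚP.≤-trans (sum-oddRecip²-growth-telescope M) (ℚP.≤ᵇ⇒≤ tt))

tBelow-head-≤ : ∀ a ks → All (1 ℕ.≤_) ks → ∀ M → tBelow (2 ℕ.+ a ∷ ks) M ≤ pow ⅔ (a ℕ.+ weight ks) * (+ 2 / 1)
tBelow-head-≤ a ks ks≥1 M = begin
  sumFrom2Below M (λ j → pow (oddRecip j) (2 ℕ.+ a) * tBelow ks j)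
    ≤⟨ sumFrom2Below-≤-*ˡ c termwise M ⟩
  c * sumFrom2Below M (λ j → oddRecip j * oddRecip j * growth j)
    ≤⟨ *-monoʳ-≤-0≤ c (pow-nonNeg 0≤⅔ (a ℕ.+ weight ks)) (sum-oddRecip²-growth-≤ M) ⟩
  c * (+ 2 / 1) ∎
  where
  open ℚP.≤-Reasoning
  c : ℚᵘ
  c = pow ⅔ (a ℕ.+ weight ks)
  termwise : ∀ j → pow (oddRecip j) (2 ℕ.+ a) * tBelow ks j ≤ c * (oddRecip j * oddRecip j * growth j)
  termwise j = begin
    pow (oddRecip j) (2 ℕ.+ a) * tBelow ks j
      ≤⟨ *-mono-≤-0≤ (pow-nonNeg (oddRecip-nonNeg j) (2 ℕ.+ a)) (tBelow-nonNeg ks j)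
                     (pow-2+-≤ (oddRecip-nonNeg j) (oddRecip-≤⅔ j) a) (tBelow-≤-growth ks ks≥1 j) ⟩
    (pow ⅔ a * (oddRecip j * oddRecip j)) * (pow ⅔ (weight ks) * growth j)
      ≃⟨ solve 4 (λ a x b g → (a :* (x :* x)) :* (b :* g) := (a :* b) :* (x :* x :* g))
               ℚP.≃-refl (pow ⅔ a) (oddRecip j) (pow ⅔ (weight ks)) (growth j) ⟩
    (pow ⅔ a * pow ⅔ (weight ks)) * (oddRecip j * oddRecip j * growth j)
      ≃⟨ ℚP.*-congʳ (ℚP.≃-sym (pow-distribˡ-+-* ⅔ a (weight ks))) ⟩
    c * (oddRecip j * oddRecip j * growth j) ∎

⅔-*-3+n≤2+n : ∀ n → ⅔ * (+ (3 ℕ.+ n) / 1) ≤ + (2 ℕ.+ n) / 1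
⅔-*-3+n≤2+n n = *≤* (ℤ.+≤+ (begin
  _                    ≡⟨ ℕ-solve [ n ] ⟩
  6 ℕ.+ 2 ℕ.* n        ≤⟨ ℕP.m≤m+n _ n ⟩
  6 ℕ.+ 2 ℕ.* n ℕ.+ n  ≡⟨ ℕ-solve [ n ] ⟩
  _                    ∎))
  where open ℕP.≤-Reasoning

pow-⅔-*-≤ : ∀ n → pow ⅔ n * (+ (2 ℕ.+ n) / 1) ≤ + 2 / 1
pow-⅔-*-≤ zero    = ℚP.≤ᵇ⇒≤ tt
pow-⅔-*-≤ (suc n) = begin
  (⅔ * pow ⅔ n) * (+ (3 ℕ.+ n) / 1)   ≃⟨ solve 3 (λ r p m → (r :* p) :* m := p :* (r :* m)) ℚP.≃-refl ⅔ (pow ⅔ n) _ ⟩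
  pow ⅔ n * (⅔ * (+ (3 ℕ.+ n) / 1))   ≤⟨ *-monoʳ-≤-0≤ (pow ⅔ n) (pow-nonNeg 0≤⅔ n) (⅔-*-3+n≤2+n n) ⟩
  pow ⅔ n * (+ (2 ℕ.+ n) / 1)         ≤⟨ pow-⅔-*-≤ n ⟩
  + 2 / 1                             ∎
  where open ℚP.≤-Reasoning

4<ε*[2+n] : ∀ p d n → 4 ℕ.* suc d ℕ.≤ n → + 4 / 1 < mkℚᵘ +[1+ p ] d * (+ (2 ℕ.+ n) / 1)
4<ε*[2+n] p d n 4[1+d]≤n = *<* (ℤ.+<+ (begin-strict
  4 ℕ.* (suc d ℕ.* 1)       ≡⟨ cong (4 ℕ.*_) (ℕP.*-identityʳ (suc d)) ⟩
  4 ℕ.* suc d                ≤⟨ 4[1+d]≤n ⟩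
  n                          <⟨ ℕP.m<n+m n (s≤s z≤n) ⟩
  2 ℕ.+ n                    ≤⟨ ℕP.m≤m+n (2 ℕ.+ n) (p ℕ.* (2 ℕ.+ n)) ⟩
  suc p ℕ.* (2 ℕ.+ n)        ≡⟨ ℕP.*-identityʳ (suc p ℕ.* (2 ℕ.+ n)) ⟨
  suc p ℕ.* (2 ℕ.+ n) ℕ.* 1  ∎))
  where open ℕP.≤-Reasoning

pow-⅔-*2-eventually-< : ∀ ε → 0ℚᵘ < ε → ∃[ N ] (∀ n → N ℕ.≤ n → pow ⅔ n * (+ 2 / 1) < ε)
pow-⅔-*2-eventually-< (mkℚᵘ +[1+ p ] d) _ =
  4 ℕ.* suc d , λ n N≤n → ℚP.*-cancelʳ-<-nonNeg (+ (2 ℕ.+ n) / 1) (begin-strict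
    (pow ⅔ n * (+ 2 / 1)) * (+ (2 ℕ.+ n) / 1)   ≃⟨ solve 3 (λ a b c → (a :* b) :* c := b :* (a :* c)) ℚP.≃-refl
                                                           (pow ⅔ n) (+ 2 / 1) (+ (2 ℕ.+ n) / 1) ⟩
    + 2 / 1 * (pow ⅔ n * (+ (2 ℕ.+ n) / 1))     ≤⟨ *-monoʳ-≤-0≤ (+ 2 / 1) (ℚP.nonNegative⁻¹ (+ 2 / 1)) (pow-⅔-*-≤ n) ⟩
    + 2 / 1 * (+ 2 / 1)                         ≤⟨ ℚP.≤ᵇ⇒≤ tt ⟩
    + 4 / 1                                     <⟨ 4<ε*[2+n] p d n N≤n ⟩
    mkℚᵘ +[1+ p ] d * (+ (2 ℕ.+ n) / 1)         ∎)
  where open ℚP.≤-Reasoning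
pow-⅔-*2-eventually-< (mkℚᵘ (+ 0)    d) (*<* (ℤ.+<+ ()))
pow-⅔-*2-eventually-< (mkℚᵘ -[1+ p ] d) (*<* ())

tBelow-pos : ∀ ks M → 2 ℕ.+ length ks ℕ.≤ M → 0ℚᵘ < tBelow ks M
tBelow-pos []       M _ = ℚP.positive⁻¹ 1ℚᵘ
tBelow-pos (k ∷ ks) (suc (suc zero)) (s≤s (s≤s ()))
tBelow-pos (k ∷ ks) (suc M@(suc (suc j))) (s≤s 2+∣ks∣≤M) =
  ℚP.<-respˡ-≃ (ℚP.+-identityˡ 0ℚᵘ)
    (ℚP.+-mono-≤-< (sumFrom2Below-nonNeg (λ m → 0≤* (pow-nonNeg (oddRecip-nonNeg m) k) (tBelow-nonNeg ks m)) M)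
                   (0<* (pow-pos (oddRecip-pos j) k) (tBelow-pos ks M 2+∣ks∣≤M)))

tBelow-≤-suc : ∀ ks M → tBelow ks M ≤ tBelow ks (suc M)
tBelow-≤-suc []       M = ℚP.≤-refl
tBelow-≤-suc (k ∷ ks) M =
  sumFrom2Below-≤-suc (λ m → 0≤* (pow-nonNeg (oddRecip-nonNeg m) k) (tBelow-nonNeg ks m)) M

tBelow-mono-≤ : ∀ ks {M M′} → M ℕ.≤ M′ → tBelow ks M ≤ tBelow ks M′
tBelow-mono-≤ ks {M} M≤M′ = from-≤′ (ℕP.≤⇒≤′ M≤M′)
  where
  from-≤′ : ∀ {N} → M ℕ.≤′ N → tBelow ks M ≤ tBelow ks N
  from-≤′ ℕ.≤′-refl          = ℚP.≤-refl
  from-≤′ (ℕ.≤′-step M≤′N) = ℚP.≤-trans (from-≤′ M≤′N) (tBelow-≤-suc ks _)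

eventually-<-ε+ε+ε : ∀ {a b β : ℕ → ℚᵘ} {ε} → 0ℚᵘ < ε →
                     TendsToZero (λ n → a n - β n) → TendsToZero (λ n → b n - β n) →
                     (∀ n → a n < ε) → ∃[ N ] (∀ n → N ℕ.≤ n → b n < ε + ε + ε)
eventually-<-ε+ε+ε {a} {b} {β} {ε} 0<ε a→β b→β a<ε with a→β ε 0<ε | b→β ε 0<ε
... | Na , a≈β | Nb , b≈β = Na ⊔ Nb , λ n N≤n → begin-strict
  b n
    ≃⟨ solve 3 (λ a b β → b := (b :- β) :+ (:- (a :- β)) :+ a) ℚP.≃-refl (a n) (b n) (β n) ⟩
  (b n - β n) + - (a n - β n) + a n
    <⟨ ℚP.+-mono-< (ℚP.+-mono-< (ℚP.≤-<-trans (p≤∣p∣ _) (b≈β n (ℕP.≤-trans (ℕP.m≤n⊔m Na Nb) N≤n)))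
                               (ℚP.≤-<-trans (-p≤∣p∣ _) (a≈β n (ℕP.≤-trans (ℕP.m≤m⊔n Na Nb) N≤n))))
                   (a<ε n) ⟩
  ε + ε + ε ∎
  where open ℚP.≤-Reasoning

boundedLists : ℕ → ℕ → List (List ℕ)
boundedLists zero    b = [ [] ]
boundedLists (suc n) b = [] ∷ cartesianProductWith _∷_ (upTo b) (boundedLists n b)

∈-boundedLists : ∀ n b {l} → length l ℕ.≤ n → All (ℕ._< b) l → l ∈ boundedLists n b
∈-boundedLists zero    b {[]}    _            _          = here refl
∈-boundedLists (suc n) b {[]}    _            _          = here refl
∈-boundedLists (suc n) b {e ∷ l} (s≤s ∣l∣≤n) (e<b ∷ l<b) =
  there (∈-cartesianProductWith⁺ _∷_ (∈-upTo⁺ e<b) (∈-boundedLists n b ∣l∣≤n l<b))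

length≤weight : ∀ {l} → All (1 ℕ.≤_) l → length l ℕ.≤ weight l
length≤weight []          = z≤n
length≤weight (1≤e ∷ 1≤l) = ℕP.+-mono-≤ 1≤e (length≤weight 1≤l)

All-≤-weight : ∀ l → All (ℕ._≤ weight l) l
All-≤-weight []      = []
All-≤-weight (e ∷ l) =
  ℕP.m≤m+n e (weight l) ∷ All.map (λ x≤w → ℕP.≤-trans x≤w (ℕP.m≤n+m (weight l) e)) (All-≤-weight l)

∈-boundedLists-weight : ∀ {W l} → All (1 ℕ.≤_) l → weight l ℕ.< W → l ∈ boundedLists W W
∈-boundedLists-weight {W} {l} 1≤l w<W =
  ∈-boundedLists W W (ℕP.≤-trans (length≤weight 1≤l) (ℕP.<⇒≤ w<W))
                     (All.map (λ e≤w → ℕP.≤-<-trans e≤w w<W) (All-≤-weight l))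

admissible⇒positive : ∀ {k} → Admissible k → All (1 ℕ.≤_) k
admissible⇒positive {k ∷ ks} (2≤k , 1≤ks) = ℕP.≤-trans (s≤s z≤n) 2≤k ∷ 1≤ks

p*⅓+p*⅓+p*⅓≃p : ∀ p → p * ⅓ + p * ⅓ + p * ⅓ ≃ p
p*⅓+p*⅓+p*⅓≃p p = begin-equality
  p * ⅓ + p * ⅓ + p * ⅓   ≃⟨ solve 2 (λ p t → p :* t :+ p :* t :+ p :* t := p :* (t :+ t :+ t)) ℚP.≃-refl p ⅓ ⟩
  p * (⅓ + ⅓ + ⅓)         ≃⟨ ℚP.*-congˡ {p} {⅓ + ⅓ + ⅓} {1ℚᵘ} (*≡* refl) ⟩
  p * 1ℚᵘ                 ≃⟨ ℚP.*-identityʳ p ⟩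
  p                       ∎
  where open ℚP.≤-Reasoning

-- β is at least the positive partial sum c of t(k₀)_1, while indices of large weight have all
-- partial sums below c / 3.
solutions-weight-bounded : ∀ {β k₀} → tEq k₀ β → ∃[ W ] (∀ k → Admissible k → tEq k β → weight k ℕ.< W)
solutions-weight-bounded {β} {k₀} k₀-sol =
  let N , decay = pow-⅔-*2-eventually-< ε 0<ε in 2 ℕ.+ N , bound N decay
  where
  c ε : ℚᵘ
  c = tBelow k₀ (2 ℕ.+ length k₀)
  ε = c * ⅓
  0<ε : 0ℚᵘ < ε
  0<ε = 0<* (tBelow-pos k₀ (2 ℕ.+ length k₀) ℕP.≤-refl) (ℚP.positive⁻¹ ⅓)

  bound : ∀ N → (∀ n → N ℕ.≤ n → pow ⅔ n * (+ 2 / 1) < ε) →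
          ∀ k → Admissible k → tEq k β → weight k ℕ.< 2 ℕ.+ N
  bound N decay (suc (suc a) ∷ ks) (_ , 1≤ks) k-sol = s≤s (s≤s (ℕP.≰⇒> heavy-impossible))
    where
    heavy-impossible : ¬ (N ℕ.≤ a ℕ.+ weight ks)
    heavy-impossible N≤w with eventually-<-ε+ε+ε {tPartial (2 ℕ.+ a ∷ ks)} {tPartial k₀} 0<ε k-sol k₀-sol
                                (λ n → ℚP.≤-<-trans (tBelow-head-≤ a ks 1≤ks (suc n)) (decay _ N≤w))
    ... | N′ , k₀-small = ℚP.<-irrefl ℚP.≃-refl (begin-strict
      c                  ≤⟨ tBelow-mono-≤ k₀ (s≤s (ℕP.m≤n⊔m N′ (suc (length k₀)))) ⟩
      tPartial k₀ n      <⟨ k₀-small n (ℕP.m≤m⊔n N′ _) ⟩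
      ε + ε + ε          ≃⟨ p*⅓+p*⅓+p*⅓≃p c ⟩
      c                  ∎)
      where
      open ℚP.≤-Reasoning
      n : ℕ
      n = N′ ⊔ suc (length k₀)
  bound N decay (1 ∷ _) (s≤s () , _) _

finitely-many-solutions : ∀ β → Dec (∃[ k ] (Admissible k × tEq k β)) →
                          ∃[ L ] (∀ k → Admissible k → tEq k β → k ∈ L)
finitely-many-solutions β (yes (k₀ , _ , k₀-sol)) =
  let W , bound = solutions-weight-bounded {β} {k₀} k₀-sol
  in boundedLists W W , λ k adm sol → ∈-boundedLists-weight (admissible⇒positive adm) (bound k adm sol)
finitely-many-solutions β (no none) = [] , λ k adm sol → ⊥-elim (none (k , adm , sol))

corollary2p6 : (β : ℕ → ℚᵘ) →
    ¬ ¬ (∃[ L ] (∀ (k : List ℕ) → Admissible k → tEq k β → k ∈ L))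
corollary2p6 β = ¬¬-map (finitely-many-solutions β) ¬¬-excluded-middle
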